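{- Let $k\geq 2$, let $\mathcal{F}$ be a finite linear $k$-uniform family and let $\mathcal{M}$ be a maximum matching of $\mathcal{F}$. If $B=\{x_1,\dots,x_k\}\in\mathcal{M}$ and $d_1(x_i,\mathcal{M})\geq k$ for some $1\leq i\leq k$, then $d_1(x_j,\mathcal{M})=0$ for all $1\leq j\leq k$ with $j\neq i$.
   Context: A family is $k$-uniform if every member has exactly $k$ elements and linear if distinct members share at most one element. A matching is a set of pairwise disjoint members; a maximum matching is one of largest size. $X_{\mathcal{M}}=\bigcup_{A\in\mathcal{M}}A$. $D_1(\mathcal{F},\mathcal{M})=\{A\in\mathcal{F}: |A\cap X_{\mathcal{M}}|=1\}$, and for a vertex $x$, $d_1(x,\mathcal{M})=|\{A\in D_1(\mathcal{F},\mathcal{M}): x\in A\}|$. -}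

module Defs where

open import Data.Nat using (ℕ; zero; suc; _≤_; _≟_)
open import Data.Fin using (Fin)
open import Data.Fin.Subset using (Subset; _∈_; _∩_; ⋃; ∣_∣)
open import Data.Fin.Subset.Properties using (_∈?_)
open import Data.List using (List; []; _∷_; length)
import Data.List.Membership.Propositional as LM
open import Data.List.Relation.Unary.All using (All)
open import Data.List.Relation.Unary.Unique.Propositional using (Unique)
open import Relation.Binary.PropositionalEquality using (_≡_; _≢_)
open import Relation.Nullary using (yes; no)

-- A finite family of subsets of the ground set Fin n is a duplicate-free list.
Family : ℕ → Set
Family n = List (Subset n)

Uniform : ∀ {n} → ℕ → Family n → Set
Uniform k F = All (λ A → ∣ A ∣ ≡ k) F

Linear : ∀ {n} → Family n → Set
Linear F = ∀ {A B} → A LM.∈ F → B LM.∈ F → A ≢ B → ∣ A ∩ B ∣ ≤ 1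

IsMatching : ∀ {n} → Family n → List (Subset n) → Set
IsMatching F M =
  Unique M
  × (∀ {A} → A LM.∈ M → A LM.∈ F)
  × (∀ {A B} → A LM.∈ M → B LM.∈ M → A ≢ B → ∣ A ∩ B ∣ ≡ 0)
  where open import Data.Product using (_×_)

IsMaximumMatching : ∀ {n} → Family n → List (Subset n) → Set
IsMaximumMatching F M =
  IsMatching F M × (∀ M′ → IsMatching F M′ → length M′ ≤ length M)
  where open import Data.Product using (_×_)

X : ∀ {n} → List (Subset n) → Subset n
X M = ⋃ M

d₁ : ∀ {n} → Family n → List (Subset n) → Fin n → ℕ
d₁ F M x = go F
  where
  go : List _ → ℕ
  go [] = 0
  go (A ∷ As) with ∣ A ∩ X M ∣ ≟ 1 | x ∈? A
  ... | yes _ | yes _ = suc (go As)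
  ... | _     | _     = go As

-- Suppose some C ∈ D₁(F, M) contains y, and let A₁, …, A_k be members of D₁(F, M)
-- containing x. Each Aᵢ meets X_M only in x and C only in y, so x ∉ C and y ∉ Aᵢ.
-- If some Aᵢ misses C, then replacing B by Aᵢ and C enlarges the maximum matching M.
-- Otherwise the traces Aᵢ ∩ C are nonempty subsets of C - y, pairwise disjoint by
-- linearity (Aᵢ ∩ Aⱼ = {x} and x ∉ C), so k ≤ |C - y| = k - 1.
module Submission where

open import Defs
open import Data.Nat using (ℕ; _≤_)
open import Data.Fin using (Fin)
open import Data.Fin.Subset using (Subset; _∈_)
open import Data.List.Membership.Propositional using () renaming (_∈_ to _∈ₗ_)
open import Data.List.Relation.Unary.Unique.Propositional using (Unique)
open import Relation.Binary.PropositionalEquality using (_≡_; _≢_)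

open import Data.Nat using (suc; z≤n; s≤s; _<_; _≟_)
open import Data.Nat.Properties using (<⇒≱; ≤-trans; ≤-reflexive; ≤-pred; n≤0⇒n≡0; n≮0; 1+n≰n; module ≤-Reasoning)
import Data.Fin as Fin
open import Data.Fin.Subset using (_∉_; _⊆_; _∩_; _-_; ∣_∣; Nonempty; Empty)
open import Data.Fin.Subset.Properties
  using (_∈?_; nonempty?; Empty-unique; ∣⊥∣≡0; ∩-comm; x∈p∩q⁺; x∈p∩q⁻; p⊆p∪q; q⊆p∪q; ⊆-trans;
         x∈p⇒∣p-x∣<∣p∣; x∈p∧x≢y⇒x∈p-y)
open import Data.List using (List; []; _∷_; length; map; filter)
open import Data.List.Properties using (length-map; filter-accept; filter-reject; filter-none)
open import Data.List.Membership.Propositional using (find)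
open import Data.List.Membership.Propositional.Properties using (∈-filter⁻)
open import Data.List.Relation.Binary.Subset.Propositional using () renaming (_⊆_ to _⊆ₗ_)
open import Data.List.Relation.Unary.All as All using (All; []; _∷_; all?)
open import Data.List.Relation.Unary.All.Properties using (anti-mono; ¬All⇒Any¬)
import Data.List.Relation.Unary.All.Properties as Allₚ
open import Data.List.Relation.Unary.AllPairs using (AllPairs; []; _∷_)
import Data.List.Relation.Unary.AllPairs.Properties as AllPairs
open import Data.List.Relation.Unary.Any using (here; there)
open import Data.List.Relation.Unary.Unique.Propositional.Properties using (filter⁺)
open import Data.Product using (∃; _×_; _,_; proj₁; proj₂)
open import Data.Empty using (⊥)
open import Function using (_∘_; id)
open import Relation.Nullary using (¬_; yes; no; contradiction)
open import Relation.Nullary.Decidable using (Dec; _×-dec_)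
open import Relation.Binary.PropositionalEquality using (refl; sym; trans; cong; subst; ≢-sym; module ≡-Reasoning)

private
  variable
    n : ℕ
    p q : Subset n
    x y z : Fin n

∣p∣≡0⇒Empty : ∣ p ∣ ≡ 0 → Empty p
∣p∣≡0⇒Empty {p = p} ∣p∣≡0 (x , x∈p) = n≮0 (subst (∣ p - x ∣ <_) ∣p∣≡0 (x∈p⇒∣p-x∣<∣p∣ x∈p))

Empty⇒∣p∣≡0 : ∀ {n} {p : Subset n} → Empty p → ∣ p ∣ ≡ 0
Empty⇒∣p∣≡0 {n} {p} empty = trans (cong ∣_∣ (Empty-unique {p = p} empty)) (∣⊥∣≡0 n)

∣p∣≤1⇒x≡y : ∣ p ∣ ≤ 1 → x ∈ p → y ∈ p → x ≡ y
∣p∣≤1⇒x≡y {p = p} {x} {y} ∣p∣≤1 x∈p y∈p with x Fin.≟ y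
... | yes x≡y = x≡y
... | no x≢y = contradiction (y , x∈p∧x≢y⇒x∈p-y y∈p (≢-sym x≢y)) (∣p∣≡0⇒Empty ∣p-x∣≡0)
  where
  ∣p-x∣≡0 : ∣ p - x ∣ ≡ 0
  ∣p-x∣≡0 = n≤0⇒n≡0 (≤-pred (≤-trans (x∈p⇒∣p-x∣<∣p∣ x∈p) ∣p∣≤1))

Disjoint : Subset n → Subset n → Set
Disjoint p q = Empty (p ∩ q)

Disjoint-sym : Disjoint p q → Disjoint q p
Disjoint-sym {p = p} {q} = subst Empty (∩-comm p q)

disjoint⁻ : Disjoint p q → z ∈ p → z ∉ q
disjoint⁻ p#q z∈p z∈q = p#q (_ , x∈p∩q⁺ (z∈p , z∈q))

-- The members after T avoid a chosen point z ∈ T, so they fit into p - z.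
disjoint∧nonempty⇒length≤∣p∣ : (Ts : List (Subset n)) → AllPairs Disjoint Ts →
  All Nonempty Ts → All (_⊆ p) Ts → length Ts ≤ ∣ p ∣
disjoint∧nonempty⇒length≤∣p∣ [] _ _ _ = z≤n
disjoint∧nonempty⇒length≤∣p∣ {p = p} (T ∷ Ts) (T#Ts ∷ disjoint) ((z , z∈T) ∷ nonempty) (T⊆p ∷ Ts⊆p) =
  ≤-trans (s≤s (disjoint∧nonempty⇒length≤∣p∣ Ts disjoint nonempty (All.zipWith ⊆p-z (T#Ts , Ts⊆p))))
          (x∈p⇒∣p-x∣<∣p∣ (T⊆p z∈T))
  where
  ⊆p-z : ∀ {S} → Disjoint T S × S ⊆ p → S ⊆ p - z
  ⊆p-z (T#S , S⊆p) w∈S = x∈p∧x≢y⇒x∈p-y (S⊆p w∈S) λ { refl → disjoint⁻ T#S z∈T w∈S }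

Pendant : List (Subset n) → Fin n → Subset n → Set
Pendant M x A = ∣ A ∩ X M ∣ ≡ 1 × x ∈ A

pendant? : (M : List (Subset n)) (x : Fin n) (A : Subset n) → Dec (Pendant M x A)
pendant? M x A = (∣ A ∩ X M ∣ ≟ 1) ×-dec (x ∈? A)

-- The counter local to d₁ does not depend on F, so its count of the tail is d₁ F M x itself.
d₁-accept : {F M : Family n} {A : Subset n} → Pendant M x A → d₁ (A ∷ F) M x ≡ suc (d₁ F M x)
d₁-accept {x = x} {M = M} {A} (∣A∩X∣≡1 , x∈A) with ∣ A ∩ X M ∣ ≟ 1 | x ∈? A
... | yes _ | yes _ = refl
... | no ∣A∩X∣≢1 | _ = contradiction ∣A∩X∣≡1 ∣A∩X∣≢1
... | yes _ | no x∉A = contradiction x∈A x∉A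

d₁-reject : {F M : Family n} {A : Subset n} → ¬ Pendant M x A → d₁ (A ∷ F) M x ≡ d₁ F M x
d₁-reject {x = x} {M = M} {A} ¬pendant with ∣ A ∩ X M ∣ ≟ 1 | x ∈? A
... | yes ∣A∩X∣≡1 | yes x∈A = contradiction (∣A∩X∣≡1 , x∈A) ¬pendant
... | yes _ | no _ = refl
... | no _ | _ = refl

d₁≡length-filter : (F M : Family n) (x : Fin n) → d₁ F M x ≡ length (filter (pendant? M x) F)
d₁≡length-filter [] M x = refl
d₁≡length-filter (A ∷ F) M x with pendant? M x A
... | yes pendant = begin
  d₁ (A ∷ F) M x                               ≡⟨ d₁-accept pendant ⟩
  suc (d₁ F M x)                               ≡⟨ cong suc (d₁≡length-filter F M x) ⟩
  suc (length (filter (pendant? M x) F))       ≡⟨ cong length (filter-accept (pendant? M x) pendant) ⟨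
  length (filter (pendant? M x) (A ∷ F))       ∎
  where open ≡-Reasoning
... | no ¬pendant = begin
  d₁ (A ∷ F) M x                               ≡⟨ d₁-reject ¬pendant ⟩
  d₁ F M x                                     ≡⟨ d₁≡length-filter F M x ⟩
  length (filter (pendant? M x) F)             ≡⟨ cong length (filter-reject (pendant? M x) ¬pendant) ⟨
  length (filter (pendant? M x) (A ∷ F))       ∎
  where open ≡-Reasoning

∈⇒⊆X : {D : Subset n} {M : List (Subset n)} → D ∈ₗ M → D ⊆ X M
∈⇒⊆X (here refl) = p⊆p∪q _
∈⇒⊆X {M = E ∷ M} (there D∈M) = ⊆-trans (∈⇒⊆X D∈M) (q⊆p∪q E (X M))

pendant-unique : {M : List (Subset n)} {A : Subset n} →
  Pendant M x A → x ∈ X M → z ∈ A → z ∈ X M → z ≡ x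
pendant-unique (∣A∩X∣≡1 , x∈A) x∈X z∈A z∈X =
  ∣p∣≤1⇒x≡y (≤-reflexive ∣A∩X∣≡1) (x∈p∩q⁺ (z∈A , z∈X)) (x∈p∩q⁺ (x∈A , x∈X))

unique-pivot : {M : List (Subset n)} {B : Subset n} → Unique M → B ∈ₗ M →
  ∃ λ R → Unique (B ∷ R) × (B ∷ R) ⊆ₗ M × length M ≡ length (B ∷ R)
unique-pivot unique (here refl) = _ , unique , id , refl
unique-pivot {M = D ∷ M} {B} (D∉M ∷ uniqueM) (there B∈M) with unique-pivot uniqueM B∈M
... | R , B∉R ∷ uniqueR , BR⊆M , |M|≡ =
  D ∷ R , (≢-sym (All.lookup D∉M B∈M) ∷ B∉R) ∷ anti-mono (BR⊆M ∘ there) D∉M ∷ uniqueR ,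
  BDR⊆DM , cong suc |M|≡
  where
  BDR⊆DM : (B ∷ D ∷ R) ⊆ₗ (D ∷ M)
  BDR⊆DM (here refl) = there (BR⊆M (here refl))
  BDR⊆DM (there (here refl)) = here refl
  BDR⊆DM (there (there E∈R)) = there (BR⊆M (there E∈R))

module _ {F : Family n} where

  matching-⊆ : {M N : List (Subset n)} → IsMatching F M → Unique N → N ⊆ₗ M → IsMatching F N
  matching-⊆ (_ , M⊆F , disjoint) uniqueN N⊆M =
    uniqueN , M⊆F ∘ N⊆M , λ D∈N E∈N → disjoint (N⊆M D∈N) (N⊆M E∈N)

  matching-∷ : {M : List (Subset n)} {A : Subset n} → IsMatching F M → A ∈ₗ F → Nonempty A →
    All (Disjoint A) M → IsMatching F (A ∷ M)
  matching-∷ {M} {A} (uniqueM , M⊆F , disjointM) A∈F (a , a∈A) A#M =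
    All.map A≢ A#M ∷ uniqueM , AM⊆F , disjoint
    where
    A≢ : ∀ {D} → Disjoint A D → A ≢ D
    A≢ A#A refl = disjoint⁻ A#A a∈A a∈A
    AM⊆F : (A ∷ M) ⊆ₗ F
    AM⊆F (here refl) = A∈F
    AM⊆F (there D∈M) = M⊆F D∈M
    disjoint : ∀ {D E} → D ∈ₗ A ∷ M → E ∈ₗ A ∷ M → D ≢ E → ∣ D ∩ E ∣ ≡ 0
    disjoint (here refl) (here refl) A≢A = contradiction refl A≢A
    disjoint (here refl) (there E∈M) _ = Empty⇒∣p∣≡0 (All.lookup A#M E∈M)
    disjoint (there D∈M) (here refl) _ = Empty⇒∣p∣≡0 (Disjoint-sym (All.lookup A#M D∈M))
    disjoint (there D∈M) (there E∈M) D≢E = disjointM D∈M E∈M D≢E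

  -- Removing B from M and adding A and C would give a larger matching.
  maximum⇒¬two-for-one : {M : List (Subset n)} {A B C : Subset n} →
    IsMaximumMatching F M → B ∈ₗ M → A ∈ₗ F → C ∈ₗ F → Nonempty A → Nonempty C → Disjoint A C →
    (∀ {D} → D ∈ₗ M → D ≢ B → Disjoint A D × Disjoint C D) → ⊥
  maximum⇒¬two-for-one {A = A} {C = C} (matching , maximum) B∈M A∈F C∈F A≢∅ C≢∅ A#C avoids
    with unique-pivot (proj₁ matching) B∈M
  ... | R , B∉R ∷ uniqueR , BR⊆M , |M|≡ =
    1+n≰n (≤-trans (maximum _ ACR-matching) (≤-reflexive |M|≡))
    where
    avoidsR : ∀ {D} → D ∈ₗ R → Disjoint A D × Disjoint C D
    avoidsR D∈R = avoids (BR⊆M (there D∈R)) (≢-sym (All.lookup B∉R D∈R))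
    ACR-matching : IsMatching F (A ∷ C ∷ R)
    ACR-matching =
      matching-∷ (matching-∷ (matching-⊆ matching uniqueR (BR⊆M ∘ there)) C∈F C≢∅
                              (All.tabulate (proj₂ ∘ avoidsR)))
                 A∈F A≢∅ (A#C ∷ All.tabulate (proj₁ ∘ avoidsR))

Unique⇒AllPairs : ∀ {a r} {A : Set a} {R : A → A → Set r} {xs : List A} → Unique xs →
  (∀ {u v} → u ∈ₗ xs → v ∈ₗ xs → u ≢ v → R u v) → AllPairs R xs
Unique⇒AllPairs [] _ = []
Unique⇒AllPairs (u∉xs ∷ unique) R-distinct =
  All.tabulate (λ v∈xs → R-distinct (here refl) (there v∈xs) (All.lookup u∉xs v∈xs))
  ∷ Unique⇒AllPairs unique (λ u∈xs v∈xs → R-distinct (there u∈xs) (there v∈xs))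

linear⇒traces-disjoint : {F : Family n} {A A′ C : Subset n} → Linear F → A ∈ₗ F → A′ ∈ₗ F →
  A ≢ A′ → x ∈ A → x ∈ A′ → x ∉ C → Disjoint (A ∩ C) (A′ ∩ C)
linear⇒traces-disjoint {A = A} {A′} {C} linear A∈F A′∈F A≢A′ x∈A x∈A′ x∉C (z , z∈traces) =
  let z∈A∩C , z∈A′∩C = x∈p∩q⁻ (A ∩ C) (A′ ∩ C) z∈traces
      z∈A , z∈C = x∈p∩q⁻ A C z∈A∩C
      z∈A′ , _ = x∈p∩q⁻ A′ C z∈A′∩C
      z≡x = ∣p∣≤1⇒x≡y (linear A∈F A′∈F A≢A′) (x∈p∩q⁺ (z∈A , z∈A′)) (x∈p∩q⁺ (x∈A , x∈A′))
  in x∉C (subst (_∈ C) z≡x z∈C)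

pendant-disjoint-other : {F M : Family n} {A B D : Subset n} → IsMatching F M → B ∈ₗ M → x ∈ B →
  Pendant M x A → D ∈ₗ M → D ≢ B → Disjoint A D
pendant-disjoint-other {x = x} {M = M} {A} {D = D} (_ , _ , disjoint) B∈M x∈B pendant D∈M D≢B (z , z∈A∩D) =
  let z∈A , z∈D = x∈p∩q⁻ A D z∈A∩D
      z≡x = pendant-unique {M = M} pendant (∈⇒⊆X B∈M x∈B) z∈A (∈⇒⊆X D∈M z∈D)
  in ∣p∣≡0⇒Empty (disjoint D∈M B∈M D≢B) (x , x∈p∩q⁺ (subst (_∈ D) z≡x z∈D , x∈B))

module _ {k : ℕ} {F M : Family n} (uniform : Uniform k F) (linear : Linear F)
         (maximum : IsMaximumMatching F M) {B : Subset n} (B∈M : B ∈ₗ M)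
         {x y : Fin n} (x∈B : x ∈ B) (y∈B : y ∈ B) (y≢x : y ≢ x)
         {C : Subset n} (C∈F : C ∈ₗ F) (C-pendant : Pendant M y C) where

  private
    pendants : List (Subset n)
    pendants = filter (pendant? M x) F

    pendant-member : {A : Subset n} → A ∈ₗ pendants → A ∈ₗ F × Pendant M x A
    pendant-member = ∈-filter⁻ (pendant? M x)

    x∉C : x ∉ C
    x∉C x∈C = y≢x (sym (pendant-unique {M = M} C-pendant (∈⇒⊆X B∈M y∈B) x∈C (∈⇒⊆X B∈M x∈B)))

    y∉pendant : {A : Subset n} → Pendant M x A → y ∉ A
    y∉pendant A-pendant y∈A = y≢x (pendant-unique {M = M} A-pendant (∈⇒⊆X B∈M x∈B) y∈A (∈⇒⊆X B∈M y∈B))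

    trace⊆C-y : {A : Subset n} → A ∈ₗ pendants → A ∩ C ⊆ C - y
    trace⊆C-y {A} A∈ z∈A∩C =
      let z∈A , z∈C = x∈p∩q⁻ A C z∈A∩C
      in x∈p∧x≢y⇒x∈p-y z∈C λ { refl → y∉pendant (proj₂ (pendant-member A∈)) z∈A }

  pendant-missing-C-absurd : {A : Subset n} → A ∈ₗ filter (pendant? M x) F → Disjoint A C → ⊥
  pendant-missing-C-absurd A∈ A#C =
    let A∈F , A-pendant = pendant-member A∈
        matching = proj₁ maximum
    in maximum⇒¬two-for-one maximum B∈M A∈F C∈F (x , proj₂ A-pendant) (y , proj₂ C-pendant) A#C
         λ D∈M D≢B → pendant-disjoint-other matching B∈M x∈B A-pendant D∈M D≢B
                   , pendant-disjoint-other matching B∈M y∈B C-pendant D∈M D≢B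

  pendants-meeting-C-few : Unique F → All (λ A → Nonempty (A ∩ C)) (filter (pendant? M x) F) →
    length (filter (pendant? M x) F) < k
  pendants-meeting-C-few uniqueF meet-C = begin-strict
    length pendants              ≡⟨ length-map (_∩ C) pendants ⟨
    length (map (_∩ C) pendants) ≤⟨ disjoint∧nonempty⇒length≤∣p∣ _ traces-disjoint
                                      (Allₚ.map⁺ meet-C) (Allₚ.map⁺ (All.tabulate trace⊆C-y)) ⟩
    ∣ C - y ∣                    <⟨ x∈p⇒∣p-x∣<∣p∣ (proj₂ C-pendant) ⟩
    ∣ C ∣                        ≡⟨ All.lookup uniform C∈F ⟩
    k                            ∎
    where
    open ≤-Reasoning
    traces-disjoint : AllPairs Disjoint (map (_∩ C) pendants)
    traces-disjoint = AllPairs.map⁺ (Unique⇒AllPairs (filter⁺ (pendant? M x) uniqueF) λ A∈ A′∈ A≢A′ →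
      let A∈F , _ , x∈A = pendant-member A∈
          A′∈F , _ , x∈A′ = pendant-member A′∈
      in linear⇒traces-disjoint linear A∈F A′∈F A≢A′ x∈A x∈A′ x∉C)

  pendant-at-y-absurd : Unique F → k ≤ length (filter (pendant? M x) F) → ⊥
  pendant-at-y-absurd uniqueF k≤|pendants| with all? (λ A → nonempty? (A ∩ C)) pendants
  ... | yes meet-C = <⇒≱ (pendants-meeting-C-few uniqueF meet-C) k≤|pendants|
  ... | no ¬meet-C with find (¬All⇒Any¬ (λ A → nonempty? (A ∩ C)) pendants ¬meet-C)
  ...   | _ , A∈ , A#C = pendant-missing-C-absurd A∈ A#C

lemma2 : (n k : ℕ) → 2 ≤ k → (F : Family n) → Unique F → Uniform k F → Linear F →
    (M : Family n) → IsMaximumMatching F M →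
    (B : Subset n) → B ∈ₗ M → (x : Fin n) → x ∈ B → k ≤ d₁ F M x →
    (y : Fin n) → y ∈ B → y ≢ x → d₁ F M y ≡ 0
lemma2 n k _ F uniqueF uniform linear M maximum B B∈M x x∈B k≤d₁x y y∈B y≢x = begin
  d₁ F M y                           ≡⟨ d₁≡length-filter F M y ⟩
  length (filter (pendant? M y) F)   ≡⟨ cong length (filter-none (pendant? M y) (All.tabulate no-pendant-at-y)) ⟩
  0                                  ∎
  where
  open ≡-Reasoning
  no-pendant-at-y : ∀ {C} → C ∈ₗ F → ¬ Pendant M y C
  no-pendant-at-y C∈F C-pendant =
    pendant-at-y-absurd uniform linear maximum B∈M x∈B y∈B y≢x C∈F C-pendant uniqueF
      (subst (k ≤_) (d₁≡length-filter F M x) k≤d₁x)
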